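{- Let $\alpha$ be a positive integer. For $n\ge 0$ set \[ a_n=\sum_{\substack{i,j\ge 0\\ 2i+3j\le n}}\binom{i+j}{j}\binom{n-i-2j}{i+j}3^{\,n-i-3j}(\alpha-1)^{i+2j}. \] Then \[ \lim_{n\to\infty}\left(1+(\alpha-1)\frac{a_{n-1}}{a_n}\right)=\alpha^{1/3}. \] -}

module Defs where

open import Data.Nat using (ℕ; zero; suc; _+_; _*_; _∸_; _^_; _≤?_)
open import Data.Nat.Combinatorics using (_C_)
open import Data.Integer using (+_)
open import Data.Rational using (ℚ; _/_; 0ℚ; 1ℚ) renaming (_+_ to _+ℚ_; _*_ to _*ℚ_)
open import Relation.Nullary using (yes; no)

sumUpTo : (ℕ → ℕ) → ℕ → ℕ
sumUpTo f zero    = f 0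
sumUpTo f (suc n) = sumUpTo f n + f (suc n)

term : ℕ → ℕ → ℕ → ℕ → ℕ
term α n i j with 2 * i + 3 * j ≤? n
... | yes _ = ((i + j) C j) * ((n ∸ i ∸ 2 * j) C (i + j))
              * (3 ^ (n ∸ i ∸ 3 * j)) * ((α ∸ 1) ^ (i + 2 * j))
... | no  _ = 0

-- a_n = Σ_{i,j ≥ 0, 2i+3j ≤ n} C(i+j,j) C(n-i-2j,i+j) 3^(n-i-3j) (α-1)^(i+2j)
-- (i, j ≤ n suffices since 2i+3j ≤ n)
a : ℕ → ℕ → ℕ
a α n = sumUpTo (λ i → sumUpTo (λ j → term α n i j) n) n

-- m / d as a rational, with the (irrelevant, since a_n > 0) convention m/0 = 0
ratio : ℕ → ℕ → ℚ
ratio m zero    = 0ℚ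
ratio m (suc d) = (+ m) / suc d

-- x α n = 1 + (α-1) a_n / a_{n+1}   (the sequence term at index n+1)
x : ℕ → ℕ → ℚ
x α n = 1ℚ +ℚ (((+ (α ∸ 1)) / 1) *ℚ ratio (a α n) (a α (suc n)))

{-# OPTIONS --safe #-}
module Submission where

-- Write α = 1 + t and k = n - 2i - 3j.  The (i, j) summand of a_n is the trinomial coefficient
-- (i + j + k)! / (i! j! k!) times (3t)^i (t²)^j 3^k, so Pascal's rule in each of the three
-- directions gives a_{n+3} = 3 a_{n+2} + 3t a_{n+1} + t² a_n.  For any positive solution s of
-- this recurrence, the vectors v_n = (s_{n+2} + 2t s_{n+1} + t² s_n, s_{n+2} + t s_{n+1}, s_{n+2}),
-- whose coordinates sum to s_{n+3}, are mapped to each other by the positive matrix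
-- T = [[1, α, α], [1, 1, α], [1, 1, 1]].  Componentwise bounds m v_n ≤ v_{n+1} ≤ M v_n are
-- preserved by T and can be tightened so that M - m shrinks by the factor t / α at each step
-- (Birkhoff contraction).  The bounds at three consecutive steps give m³ ≤ 3m² + 3tm + t² and
-- M³ ≥ 3M² + 3tM + t², i.e. (1 + t/M)³ ≤ α ≤ (1 + t/m)³, while m ≤ s_{n+1}/s_n ≤ M places
-- 1 + t s_n / s_{n+1} between 1 + t/M and 1 + t/m.  Hence its cube is within O(M - m) of α.

import Data.Rational as ℚ using (ℚ; 0ℚ; _≤_)

module Coefficients where

  open import Defs
  open import Data.Nat
  open import Data.Nat.Properties
  open import Data.Nat.Combinatorics using (_C_; nCk+nC[k+1]≡[n+1]C[k+1])
  open import Data.Nat.Combinatorics.Specification using (k>n⇒nCk≡0)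
  open import Data.Nat.Tactic.RingSolver using (solve-∀)
  open import Data.Product using (_,_)
  open import Data.Sum using (inj₁; inj₂)
  open import Data.Empty using (⊥-elim)
  open import Relation.Nullary using (yes; no)
  open import Relation.Binary.PropositionalEquality

  prev : (ℕ → ℕ) → ℕ → ℕ
  prev f zero    = 0
  prev f (suc k) = f k

  prev-*ʳ : ∀ (f : ℕ → ℕ) c k → prev f k * c ≡ prev (λ k′ → f k′ * c) k
  prev-*ʳ f c zero    = refl
  prev-*ʳ f c (suc k) = refl

  prev-scale : ∀ (f g : ℕ → ℕ) c k → (∀ k′ → g (suc k′) ≡ c * g k′) →
               prev f k * g k ≡ c * prev (λ k′ → f k′ * g k′) k
  prev-scale f g c zero    _      = sym (*-zeroʳ c)
  prev-scale f g c (suc k) g-suc = begin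
    f k * g (suc k)   ≡⟨ cong (f k *_) (g-suc k) ⟩
    f k * (c * g k)   ≡⟨ x*[c*y]≡c*[x*y] (f k) c (g k) ⟩
    c * (f k * g k)   ∎
    where
    open ≡-Reasoning
    x*[c*y]≡c*[x*y] : ∀ x c y → x * (c * y) ≡ c * (x * y)
    x*[c*y]≡c*[x*y] = solve-∀

  pascal : ∀ n k → suc n C k ≡ prev (n C_) k + n C k
  pascal n zero    = refl
  pascal n (suc k) = sym (nCk+nC[k+1]≡[n+1]C[k+1] n k)

  -- the trinomial coefficient C(s, j) C(s + k, s) = (s + k)! / ((s - j)! j! k!)
  pyramid : ℕ → ℕ → ℕ → ℕ
  pyramid s j k = (s C j) * ((s + k) C s)

  pyramid-pascal : ∀ s j k → pyramid (suc s) j k ≡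
    prev (pyramid (suc s) j) k + pyramid s j k + prev (λ j′ → pyramid s j′ k) j
  pyramid-pascal s j k = begin
    X * (suc (s + k) C suc s)                    ≡⟨ cong (X *_) (pascal (s + k) (suc s)) ⟩
    X * ((s + k) C s + (s + k) C suc s)          ≡⟨ *-distribˡ-+ X ((s + k) C s) _ ⟩
    X * ((s + k) C s) + X * ((s + k) C suc s)    ≡⟨ +-comm (X * ((s + k) C s)) _ ⟩
    X * ((s + k) C suc s) + X * ((s + k) C s)    ≡⟨ cong₂ _+_ (shift-k k) (cong (_* ((s + k) C s)) (pascal s j)) ⟩
    prev (pyramid (suc s) j) k + (prev (s C_) j + s C j) * ((s + k) C s)
      ≡⟨ cong (prev (pyramid (suc s) j) k +_) (*-distribʳ-+ ((s + k) C s) (prev (s C_) j) (s C j)) ⟩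
    prev (pyramid (suc s) j) k + (prev (s C_) j * ((s + k) C s) + pyramid s j k)
      ≡⟨ cong (λ y → prev (pyramid (suc s) j) k + (y + pyramid s j k)) (prev-*ʳ (s C_) _ j) ⟩
    prev (pyramid (suc s) j) k + (prev (λ j′ → pyramid s j′ k) j + pyramid s j k)
      ≡⟨ x+[y+z]≡x+z+y (prev (pyramid (suc s) j) k) _ _ ⟩
    prev (pyramid (suc s) j) k + pyramid s j k + prev (λ j′ → pyramid s j′ k) j ∎
    where
    open ≡-Reasoning
    X = suc s C j
    x+[y+z]≡x+z+y : ∀ x y z → x + (y + z) ≡ x + z + y
    x+[y+z]≡x+z+y = solve-∀
    shift-k : ∀ k → X * ((s + k) C suc s) ≡ prev (pyramid (suc s) j) k
    shift-k zero    = trans (cong (λ n → X * (n C suc s)) (+-identityʳ s))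
                            (trans (cong (X *_) (k>n⇒nCk≡0 (n<1+n s))) (*-zeroʳ X))
    shift-k (suc k) = cong (λ n → X * (n C suc s)) (+-suc s k)

  trinomial : ℕ → ℕ → ℕ → ℕ
  trinomial i j k = pyramid (i + j) j k

  trinomial-pascal : ∀ i j k → 0 < i + j + k → trinomial i j k ≡
    prev (trinomial i j) k + prev (λ i′ → trinomial i′ j k) i + prev (λ j′ → trinomial i j′ k) j
  trinomial-pascal zero    zero    (suc k) _ = refl
  trinomial-pascal zero    (suc j) k       _ = trans (pyramid-pascal j (suc j) k)
    (cong (λ y → prev (trinomial 0 (suc j)) k + y + trinomial 0 j k)
          (cong (_* ((j + k) C j)) (k>n⇒nCk≡0 (n<1+n j))))
  trinomial-pascal (suc i) j       k       _ = trans (pyramid-pascal (i + j) j k)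
    (cong (prev (trinomial (suc i) j) k + trinomial i j k +_) (shift-j j))
    where
    shift-j : ∀ j → prev (λ j′ → pyramid (i + j) j′ k) j ≡ prev (λ j′ → trinomial (suc i) j′ k) j
    shift-j zero    = refl
    shift-j (suc j) = cong (λ s → pyramid s j k) (+-suc i j)

  weight : ℕ → ℕ → ℕ → ℕ → ℕ
  weight t i j k = 3 ^ i * t ^ i * (t ^ j * t ^ j) * 3 ^ k

  weight-suc-i : ∀ t i j k → weight t (suc i) j k ≡ 3 * t * weight t i j k
  weight-suc-i t i j k = regroup t (3 ^ i) (t ^ i) (t ^ j * t ^ j) (3 ^ k)
    where
    regroup : ∀ t a b c d → 3 * a * (t * b) * c * d ≡ 3 * t * (a * b * c * d)
    regroup = solve-∀

  weight-suc-j : ∀ t i j k → weight t i (suc j) k ≡ t * t * weight t i j k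
  weight-suc-j t i j k = regroup t (3 ^ i * t ^ i) (t ^ j) (3 ^ k)
    where
    regroup : ∀ t a b d → a * (t * b * (t * b)) * d ≡ t * t * (a * (b * b) * d)
    regroup = solve-∀

  weight-suc-k : ∀ t i j k → weight t i j (suc k) ≡ 3 * weight t i j k
  weight-suc-k t i j k = regroup (3 ^ i * t ^ i) (t ^ j * t ^ j) (3 ^ k)
    where
    regroup : ∀ a b d → a * b * (3 * d) ≡ 3 * (a * b * d)
    regroup = solve-∀

  weighted : ℕ → ℕ → ℕ → ℕ → ℕ
  weighted t i j k = trinomial i j k * weight t i j k

  weighted-pascal : ∀ t i j k → 0 < i + j + k → weighted t i j k ≡
    3 * prev (weighted t i j) k + 3 * t * prev (λ i′ → weighted t i′ j k) i
      + t * t * prev (λ j′ → weighted t i j′ k) j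
  weighted-pascal t i j k 0<i+j+k = begin
    trinomial i j k * w            ≡⟨ cong (_* w) (trinomial-pascal i j k 0<i+j+k) ⟩
    (Tₖ + Tᵢ + Tⱼ) * w             ≡⟨ distribute Tₖ Tᵢ Tⱼ w ⟩
    Tₖ * w + Tᵢ * w + Tⱼ * w
      ≡⟨ cong₂ _+_ (cong₂ _+_ (prev-scale (trinomial i j) (weight t i j) 3 k (weight-suc-k t i j))
                              (prev-scale (λ i′ → trinomial i′ j k) (λ i′ → weight t i′ j k) (3 * t) i
                                          (λ i′ → weight-suc-i t i′ j k)))
                   (prev-scale (λ j′ → trinomial i j′ k) (λ j′ → weight t i j′ k) (t * t) j
                               (λ j′ → weight-suc-j t i j′ k)) ⟩
    3 * prev (weighted t i j) k + 3 * t * prev (λ i′ → weighted t i′ j k) i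
      + t * t * prev (λ j′ → weighted t i j′ k) j ∎
    where
    open ≡-Reasoning
    w  = weight t i j k
    Tₖ = prev (trinomial i j) k
    Tᵢ = prev (λ i′ → trinomial i′ j k) i
    Tⱼ = prev (λ j′ → trinomial i j′ k) j
    distribute : ∀ x y z w → (x + y + z) * w ≡ x * w + y * w + z * w
    distribute = solve-∀

  term-diagonal : ∀ t i j k → term (suc t) (2 * i + 3 * j + k) i j ≡ weighted t i j k
  term-diagonal t i j k with 2 * i + 3 * j ≤? 2 * i + 3 * j + k
  ... | no  ≰ = ⊥-elim (≰ (m≤m+n _ k))
  ... | yes _ = begin
    ((i + j) C j) * ((n ∸ i ∸ 2 * j) C (i + j)) * 3 ^ (n ∸ i ∸ 3 * j) * t ^ (i + 2 * j)
      ≡⟨ cong₂ (λ a b → ((i + j) C j) * (a C (i + j)) * 3 ^ b * t ^ (i + 2 * j))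
               (∸-cancel i (2 * j) (i + j + k) (n≡i+[2j+[i+j+k]] i j k))
               (∸-cancel i (3 * j) (i + k) (n≡i+[3j+[i+k]] i j k)) ⟩
    ((i + j) C j) * ((i + j + k) C (i + j)) * 3 ^ (i + k) * t ^ (i + 2 * j)
      ≡⟨ cong₂ (λ a b → trinomial i j k * a * b) (^-distribˡ-+-* 3 i k) t^[i+2j] ⟩
    trinomial i j k * (3 ^ i * 3 ^ k) * (t ^ i * (t ^ j * t ^ j))
      ≡⟨ regroup (trinomial i j k) (3 ^ i) (3 ^ k) (t ^ i) (t ^ j) ⟩
    weighted t i j k ∎
    where
    open ≡-Reasoning
    n = 2 * i + 3 * j + k
    ∸-cancel : ∀ a b c → n ≡ a + (b + c) → n ∸ a ∸ b ≡ c
    ∸-cancel a b c eq = trans (cong (λ m → m ∸ a ∸ b) eq)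
                              (trans (cong (_∸ b) (m+n∸m≡n a (b + c))) (m+n∸m≡n b c))
    n≡i+[2j+[i+j+k]] : ∀ i j k → 2 * i + 3 * j + k ≡ i + (2 * j + (i + j + k))
    n≡i+[2j+[i+j+k]] = solve-∀
    n≡i+[3j+[i+k]] : ∀ i j k → 2 * i + 3 * j + k ≡ i + (3 * j + (i + k))
    n≡i+[3j+[i+k]] = solve-∀
    t^[i+2j] : t ^ (i + 2 * j) ≡ t ^ i * (t ^ j * t ^ j)
    t^[i+2j] = begin
      t ^ (i + 2 * j)              ≡⟨ ^-distribˡ-+-* t i (2 * j) ⟩
      t ^ i * t ^ (j + (j + 0))    ≡⟨ cong (λ m → t ^ i * t ^ (j + m)) (+-identityʳ j) ⟩
      t ^ i * t ^ (j + j)          ≡⟨ cong (t ^ i *_) (^-distribˡ-+-* t j j) ⟩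
      t ^ i * (t ^ j * t ^ j)      ∎
    regroup : ∀ T a b c d → T * (a * b) * (c * (d * d)) ≡ T * (a * c * (d * d) * b)
    regroup = solve-∀

  term-vanishes : ∀ α n i j → n < 2 * i + 3 * j → term α n i j ≡ 0
  term-vanishes α n i j n<2i+3j with 2 * i + 3 * j ≤? n
  ... | yes ≤ = ⊥-elim (<⇒≱ n<2i+3j ≤)
  ... | no  _ = refl

  term-at : ∀ t {N} i j k → N ≡ 2 * i + 3 * j + k → term (suc t) N i j ≡ weighted t i j k
  term-at t i j k refl = term-diagonal t i j k

  term-prev-k : ∀ t n i j k → 2 * i + 3 * j + k ≡ 3 + n → term (suc t) (2 + n) i j ≡ prev (weighted t i j) k
  term-prev-k t n i j zero    eq = term-vanishes (suc t) (2 + n) i j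
    (subst (2 + n <_) (trans (sym eq) (+-identityʳ _)) (n<1+n (2 + n)))
  term-prev-k t n i j (suc k) eq = term-at t i j k (sym (suc-injective (trans (sym (shift i j k)) eq)))
    where
    shift : ∀ i j k → 2 * i + 3 * j + suc k ≡ 1 + (2 * i + 3 * j + k)
    shift = solve-∀

  term-prev-i : ∀ t n i j k → 2 * i + 3 * j + k ≡ 3 + n →
    prev (λ i′ → term (suc t) (1 + n) i′ j) i ≡ prev (λ i′ → weighted t i′ j k) i
  term-prev-i t n zero    j k eq = refl
  term-prev-i t n (suc i) j k eq = term-at t i j k (sym (suc-injective (suc-injective (trans (sym (shift i j k)) eq))))
    where
    shift : ∀ i j k → 2 * suc i + 3 * j + k ≡ 2 + (2 * i + 3 * j + k)
    shift = solve-∀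

  term-prev-j : ∀ t n i j k → 2 * i + 3 * j + k ≡ 3 + n →
    prev (λ j′ → term (suc t) n i j′) j ≡ prev (λ j′ → weighted t i j′ k) j
  term-prev-j t n i zero    k eq = refl
  term-prev-j t n i (suc j) k eq =
    term-at t i j k (sym (suc-injective (suc-injective (suc-injective (trans (sym (shift i j k)) eq)))))
    where
    shift : ∀ i j k → 2 * i + 3 * suc j + k ≡ 3 + (2 * i + 3 * j + k)
    shift = solve-∀

  term-recurrence-on-support : ∀ t n i j k → 2 * i + 3 * j + k ≡ 3 + n → term (suc t) (3 + n) i j ≡
    3 * term (suc t) (2 + n) i j + 3 * t * prev (λ i′ → term (suc t) (1 + n) i′ j) i
      + t * t * prev (λ j′ → term (suc t) n i j′) j
  term-recurrence-on-support t n i j k eq = begin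
    term (suc t) (3 + n) i j   ≡⟨ term-at t i j k (sym eq) ⟩
    weighted t i j k           ≡⟨ weighted-pascal t i j k (0<i+j+k i j k eq) ⟩
    3 * prev (weighted t i j) k + 3 * t * prev (λ i′ → weighted t i′ j k) i
      + t * t * prev (λ j′ → weighted t i j′ k) j
      ≡⟨ sym (cong₂ _+_ (cong₂ _+_ (cong (3 *_) (term-prev-k t n i j k eq))
                                    (cong (3 * t *_) (term-prev-i t n i j k eq)))
                         (cong (t * t *_) (term-prev-j t n i j k eq))) ⟩
    3 * term (suc t) (2 + n) i j + 3 * t * prev (λ i′ → term (suc t) (1 + n) i′ j) i
      + t * t * prev (λ j′ → term (suc t) n i j′) j ∎
    where
    open ≡-Reasoning
    0<i+j+k : ∀ i j k → 2 * i + 3 * j + k ≡ 3 + n → 0 < i + j + k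
    0<i+j+k zero    zero    zero    ()
    0<i+j+k zero    zero    (suc k) _ = z<s
    0<i+j+k zero    (suc j) k       _ = z<s
    0<i+j+k (suc i) j       k       _ = z<s

  term-recurrence-off-support : ∀ t n i j → 3 + n < 2 * i + 3 * j → term (suc t) (3 + n) i j ≡
    3 * term (suc t) (2 + n) i j + 3 * t * prev (λ i′ → term (suc t) (1 + n) i′ j) i
      + t * t * prev (λ j′ → term (suc t) n i j′) j
  term-recurrence-off-support t n i j 3+n<2i+3j = begin
    term α (3 + n) i j
      ≡⟨ term-vanishes α (3 + n) i j 3+n<2i+3j ⟩
    0
      ≡⟨ sym (3*0+x*0+y*0≡0 (3 * t) (t * t)) ⟩
    3 * 0 + 3 * t * 0 + t * t * 0
      ≡⟨ sym (cong₂ _+_ (cong₂ _+_ (cong (3 *_) (term-vanishes α (2 + n) i j (<-trans (n<1+n _) 3+n<2i+3j)))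
                                    (cong (3 * t *_) (below-i i 3+n<2i+3j)))
                         (cong (t * t *_) (below-j j 3+n<2i+3j))) ⟩
    3 * term α (2 + n) i j + 3 * t * prev (λ i′ → term α (1 + n) i′ j) i
      + t * t * prev (λ j′ → term α n i j′) j ∎
    where
    open ≡-Reasoning
    α = suc t
    3*0+x*0+y*0≡0 : ∀ x y → 3 * 0 + x * 0 + y * 0 ≡ 0
    3*0+x*0+y*0≡0 = solve-∀
    shift-i : ∀ i j → 2 * suc i + 3 * j ≡ 2 + (2 * i + 3 * j)
    shift-i = solve-∀
    shift-j : ∀ i j → 2 * i + 3 * suc j ≡ 3 + (2 * i + 3 * j)
    shift-j = solve-∀
    below-i : ∀ i → 3 + n < 2 * i + 3 * j → prev (λ i′ → term α (1 + n) i′ j) i ≡ 0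
    below-i zero    _  = refl
    below-i (suc i) lt = term-vanishes α (1 + n) i j
      (≤-pred (≤-pred (subst (4 + n ≤_) (shift-i i j) lt)))
    below-j : ∀ j → 3 + n < 2 * i + 3 * j → prev (λ j′ → term α n i j′) j ≡ 0
    below-j zero    _  = refl
    below-j (suc j) lt = term-vanishes α n i j
      (≤-pred (≤-pred (≤-pred (subst (4 + n ≤_) (shift-j i j) lt))))

  term-recurrence : ∀ t n i j → term (suc t) (3 + n) i j ≡
    3 * term (suc t) (2 + n) i j + 3 * t * prev (λ i′ → term (suc t) (1 + n) i′ j) i
      + t * t * prev (λ j′ → term (suc t) n i j′) j
  term-recurrence t n i j with ≤-<-connex (2 * i + 3 * j) (3 + n)
  ... | inj₁ ≤ = let k , eq = m≤n⇒∃[o]m+o≡n ≤ in term-recurrence-on-support t n i j k eq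
  ... | inj₂ > = term-recurrence-off-support t n i j >

  sumUpTo-cong : ∀ {f g : ℕ → ℕ} → (∀ i → f i ≡ g i) → ∀ n → sumUpTo f n ≡ sumUpTo g n
  sumUpTo-cong f≗g zero    = f≗g 0
  sumUpTo-cong f≗g (suc n) = cong₂ _+_ (sumUpTo-cong f≗g n) (f≗g (suc n))

  sumUpTo-linear₃ : ∀ a b c (f g h : ℕ → ℕ) n →
    sumUpTo (λ i → a * f i + b * g i + c * h i) n ≡ a * sumUpTo f n + b * sumUpTo g n + c * sumUpTo h n
  sumUpTo-linear₃ a b c f g h zero    = refl
  sumUpTo-linear₃ a b c f g h (suc n) =
    trans (cong (_+ (a * f (suc n) + b * g (suc n) + c * h (suc n))) (sumUpTo-linear₃ a b c f g h n))
          (regroup a b c (sumUpTo f n) (sumUpTo g n) (sumUpTo h n) (f (suc n)) (g (suc n)) (h (suc n)))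
    where
    regroup : ∀ a b c F G H x y z →
      a * F + b * G + c * H + (a * x + b * y + c * z) ≡ a * (F + x) + b * (G + y) + c * (H + z)
    regroup = solve-∀

  sumUpTo-zero : ∀ (f : ℕ → ℕ) → (∀ i → f i ≡ 0) → ∀ n → sumUpTo f n ≡ 0
  sumUpTo-zero f f≗0 zero    = f≗0 0
  sumUpTo-zero f f≗0 (suc n) = cong₂ _+_ (sumUpTo-zero f f≗0 n) (f≗0 (suc n))

  sumUpTo-prev : ∀ f n → sumUpTo (prev f) (suc n) ≡ sumUpTo f n
  sumUpTo-prev f zero    = refl
  sumUpTo-prev f (suc n) = cong (_+ f (suc n)) (sumUpTo-prev f n)

  sumUpTo-prev-comm : ∀ (g : ℕ → ℕ → ℕ) m i →
    sumUpTo (λ j → prev (λ i′ → g i′ j) i) m ≡ prev (λ i′ → sumUpTo (g i′) m) i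
  sumUpTo-prev-comm g m zero    = sumUpTo-zero (λ _ → 0) (λ _ → refl) m
  sumUpTo-prev-comm g m (suc i) = refl

  sumUpTo-extend : ∀ (f : ℕ → ℕ) n → (∀ i → n < i → f i ≡ 0) →
                   ∀ m → n ≤ m → sumUpTo f m ≡ sumUpTo f n
  sumUpTo-extend f n f-vanishes m n≤m = trans (cong (sumUpTo f) (sym (m∸n+n≡m n≤m))) (go (m ∸ n))
    where
    go : ∀ d → sumUpTo f (d + n) ≡ sumUpTo f n
    go zero    = refl
    go (suc d) = trans (cong (sumUpTo f (d + n) +_) (f-vanishes (suc (d + n)) (s≤s (m≤n+m n d))))
                       (trans (+-identityʳ _) (go d))

  a-on-larger-range : ∀ α N M₁ M₂ → N ≤ M₁ → N ≤ M₂ →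
    sumUpTo (λ i → sumUpTo (λ j → term α N i j) M₂) M₁ ≡ a α N
  a-on-larger-range α N M₁ M₂ N≤M₁ N≤M₂ =
    trans (sumUpTo-cong (λ i → sumUpTo-extend (term α N i) N (j-vanishes i) M₂ N≤M₂) M₁)
          (sumUpTo-extend (λ i → sumUpTo (term α N i) N) N i-vanishes M₁ N≤M₁)
    where
    i≤2i+3j : ∀ i j → i ≤ 2 * i + 3 * j
    i≤2i+3j i j = subst (i ≤_) (sym (i-split i j)) (m≤m+n i _)
      where
      i-split : ∀ i j → 2 * i + 3 * j ≡ i + (i + 3 * j)
      i-split = solve-∀
    j≤2i+3j : ∀ i j → j ≤ 2 * i + 3 * j
    j≤2i+3j i j = subst (j ≤_) (sym (j-split i j)) (m≤m+n j _)
      where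
      j-split : ∀ i j → 2 * i + 3 * j ≡ j + (2 * i + 2 * j)
      j-split = solve-∀
    j-vanishes : ∀ i j → N < j → term α N i j ≡ 0
    j-vanishes i j N<j = term-vanishes α N i j (<-≤-trans N<j (j≤2i+3j i j))
    i-vanishes : ∀ i → N < i → sumUpTo (term α N i) N ≡ 0
    i-vanishes i N<i = sumUpTo-zero _ (λ j → term-vanishes α N i j (<-≤-trans N<i (i≤2i+3j i j))) N

  a-recurrence : ∀ t n → a (suc t) (3 + n) ≡
    3 * a (suc t) (2 + n) + 3 * t * a (suc t) (1 + n) + t * t * a (suc t) n
  a-recurrence t n = begin
    a α (3 + n)
      ≡⟨ sumUpTo-cong (λ i → trans (sumUpTo-cong (term-recurrence t n i) M)
                                    (sumUpTo-linear₃ 3 (3 * t) (t * t) _ _ _ M)) M ⟩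
    sumUpTo (λ i → 3 * sumUpTo (term α (2 + n) i) M
                    + 3 * t * sumUpTo (λ j → prev (λ i′ → term α (1 + n) i′ j) i) M
                    + t * t * sumUpTo (prev (term α n i)) M) M
      ≡⟨ sumUpTo-linear₃ 3 (3 * t) (t * t) _ _ _ M ⟩
    3 * sumUpTo (λ i → sumUpTo (term α (2 + n) i) M) M
      + 3 * t * sumUpTo (λ i → sumUpTo (λ j → prev (λ i′ → term α (1 + n) i′ j) i) M) M
      + t * t * sumUpTo (λ i → sumUpTo (prev (term α n i)) M) M
      ≡⟨ cong₂ _+_ (cong₂ _+_ (cong (3 *_) (a-on-larger-range α (2 + n) M M (n≤1+n _) (n≤1+n _)))
                               (cong (3 * t *_) shifted-i))
                    (cong (t * t *_) shifted-j) ⟩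
    3 * a α (2 + n) + 3 * t * a α (1 + n) + t * t * a α n ∎
    where
    open ≡-Reasoning
    α = suc t
    M = 3 + n
    shifted-i : sumUpTo (λ i → sumUpTo (λ j → prev (λ i′ → term α (1 + n) i′ j) i) M) M ≡ a α (1 + n)
    shifted-i = begin
      sumUpTo (λ i → sumUpTo (λ j → prev (λ i′ → term α (1 + n) i′ j) i) M) M
        ≡⟨ sumUpTo-cong (sumUpTo-prev-comm (term α (1 + n)) M) M ⟩
      sumUpTo (prev (λ i → sumUpTo (term α (1 + n) i) M)) M
        ≡⟨ sumUpTo-prev _ (2 + n) ⟩
      sumUpTo (λ i → sumUpTo (term α (1 + n) i) M) (2 + n)
        ≡⟨ a-on-larger-range α (1 + n) (2 + n) M (n≤1+n _) (m≤n⇒m≤1+n (n≤1+n _)) ⟩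
      a α (1 + n) ∎
    shifted-j : sumUpTo (λ i → sumUpTo (prev (term α n i)) M) M ≡ a α n
    shifted-j = trans (sumUpTo-cong (λ i → sumUpTo-prev (term α n i) (2 + n)) M)
                      (a-on-larger-range α n M (2 + n) (≤-trans (n≤1+n _) (≤-trans (n≤1+n _) (n≤1+n _)))
                                            (m≤n⇒m≤1+n (n≤1+n _)))

  a-positive : ∀ t n → 0 < a (suc t) n
  a-positive t 0 = z<s
  a-positive t 1 = z<s
  a-positive t 2 = z<s
  a-positive t (suc (suc (suc n))) = subst (0 <_) (sym (a-recurrence t n))
    (<-≤-trans (a-positive t (suc (suc n)))
      (≤-trans (m≤m+n s (2 * s)) (≤-trans (m≤m+n (3 * s) _) (m≤m+n _ _))))
    where s = a (suc t) (2 + n)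


module RationalArithmetic where

  open import Defs using (ratio)
  open import Data.Nat as ℕ using (ℕ; suc; z≤n; s≤s)
  import Data.Nat.Properties as ℕ
  open import Data.Integer as ℤ using (+_)
  import Data.Integer.Properties as ℤ
  import Data.Nat.Coprimality as Coprime
  open import Data.Rational
  open import Data.Rational.Properties
  import Data.Rational.Unnormalised as ℚᵘ
  import Data.Rational.Unnormalised.Properties as ℚᵘ
  open import Data.Product using (∃; _×_; _,_)
  open import Data.Sum using (inj₁; inj₂)
  open import Data.Maybe.Base using (Maybe; just; nothing)
  open import Level using (0ℓ)
  open import Relation.Nullary using (yes; no; contradiction)
  open import Relation.Binary.PropositionalEquality
  import Tactic.RingSolver.Core.AlmostCommutativeRing as ACR
  open import Tactic.RingSolver using (solve-∀)

  ℚ-ring : ACR.AlmostCommutativeRing 0ℓ 0ℓ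
  ℚ-ring = ACR.fromCommutativeRing +-*-commutativeRing isZero
    where
    isZero : ∀ p → Maybe (0ℚ ≡ p)
    isZero p with 0ℚ ≟ p
    ... | yes 0≡p = just 0≡p
    ... | no  _   = nothing

  ι : ℕ → ℚ
  ι n = + n / 1

  ι≡mkℚ : ∀ n → ι n ≡ mkℚ (+ n) 0 (Coprime.sym (Coprime.1-coprimeTo n))
  ι≡mkℚ n = ↥p/↧p≡p (mkℚ (+ n) 0 (Coprime.sym (Coprime.1-coprimeTo n)))

  ι-+ : ∀ m n → ι (m ℕ.+ n) ≡ ι m + ι n
  ι-+ m n = sym (trans (cong₂ _+_ (ι≡mkℚ m) (ι≡mkℚ n)) (cong (_/ 1) m+n≡m+n))
    where
    m+n≡m+n : + m ℤ.* + 1 ℤ.+ + n ℤ.* + 1 ≡ + (m ℕ.+ n)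
    m+n≡m+n = trans (cong₂ ℤ._+_ (ℤ.*-identityʳ (+ m)) (ℤ.*-identityʳ (+ n))) (sym (ℤ.pos-+ m n))

  ι-* : ∀ m n → ι (m ℕ.* n) ≡ ι m * ι n
  ι-* m n = sym (trans (cong₂ _*_ (ι≡mkℚ m) (ι≡mkℚ n)) (cong (_/ 1) (sym (ℤ.pos-* m n))))

  ι-mono-≤ : ∀ {m n} → m ℕ.≤ n → ι m ≤ ι n
  ι-mono-≤ {m} {n} m≤n = subst₂ _≤_ (sym (ι≡mkℚ m)) (sym (ι≡mkℚ n))
    (*≤* (ℤ.*-monoʳ-≤-nonNeg (+ 1) (ℤ.+≤+ m≤n)))

  ι-mono-< : ∀ {m n} → m ℕ.< n → ι m < ι n
  ι-mono-< {m} {n} m<n = subst₂ _<_ (sym (ι≡mkℚ m)) (sym (ι≡mkℚ n))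
    (*<* (ℤ.*-monoʳ-<-pos (+ 1) (ℤ.+<+ m<n)))

  ι-nonNeg : ∀ n → 0ℚ ≤ ι n
  ι-nonNeg n = ι-mono-≤ {0} {n} z≤n

  ratio-spec : ∀ m {d} → 0 ℕ.< d → ratio m d * ι d ≡ ι m
  ratio-spec m {suc d} _ = toℚᵘ-injective (begin-equality
    toℚᵘ (ratio m (suc d) * ι (suc d))         ≃⟨ toℚᵘ-homo-* (ratio m (suc d)) (ι (suc d)) ⟩
    toℚᵘ (ratio m (suc d)) ℚᵘ.* toℚᵘ (ι (suc d))
      ≃⟨ ℚᵘ.*-cong (toℚᵘ-fromℚᵘ (ℚᵘ.mkℚᵘ (+ m) d)) (ℚᵘ.≃-reflexive (cong toℚᵘ (ι≡mkℚ (suc d)))) ⟩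
    ℚᵘ.mkℚᵘ (+ m) d ℚᵘ.* ℚᵘ.mkℚᵘ (+ suc d) 0   ≃⟨ ℚᵘ.*≡* cross ⟩
    ℚᵘ.mkℚᵘ (+ m) 0                           ≃⟨ ℚᵘ.≃-reflexive (cong toℚᵘ (ι≡mkℚ m)) ⟨
    toℚᵘ (ι m)                                 ∎)
    where
    open ℚᵘ.≤-Reasoning
    cross : (+ m ℤ.* + suc d) ℤ.* + 1 ≡ + m ℤ.* + (suc d ℕ.* 1)
    cross = trans (ℤ.*-identityʳ _) (cong (λ n → + m ℤ.* + n) (sym (ℕ.*-identityʳ (suc d))))

  archimedean : ∀ p → ∃ λ k → p < ι k
  archimedean p@(mkℚ n d _) = k , subst (p <_) (sym (ι≡mkℚ k)) (*<* n*1<k*[1+d])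
    where
    k = suc ℤ.∣ n ∣
    i≤∣i∣ : ∀ i → i ℤ.≤ + ℤ.∣ i ∣
    i≤∣i∣ (+ n)      = ℤ.≤-refl
    i≤∣i∣ ℤ.-[1+ n ] = ℤ.-≤+
    n*1<k*[1+d] : n ℤ.* + 1 ℤ.< + k ℤ.* + suc d
    n*1<k*[1+d] = ℤ.≤-<-trans (ℤ.≤-reflexive (ℤ.*-identityʳ n))
      (ℤ.≤-<-trans (i≤∣i∣ n) (ℤ.<-≤-trans (ℤ.+<+ (ℕ.n<1+n _))
        (subst (ℤ._≤ + k ℤ.* + suc d) (ℤ.*-identityʳ (+ k))
               (ℤ.*-monoˡ-≤-nonNeg (+ k) (ℤ.+≤+ (s≤s z≤n))))))

  module _ {p q : ℚ} where

    p≤q⇒0≤q-p : p ≤ q → 0ℚ ≤ q - p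
    p≤q⇒0≤q-p p≤q = subst (_≤ q - p) (+-inverseʳ p) (+-monoˡ-≤ (- p) p≤q)

    p<q⇒0<q-p : p < q → 0ℚ < q - p
    p<q⇒0<q-p p<q = subst (_< q - p) (+-inverseʳ p) (+-monoˡ-< (- p) p<q)

    0≤q-p⇒p≤q : 0ℚ ≤ q - p → p ≤ q
    0≤q-p⇒p≤q 0≤q-p = subst₂ _≤_ (+-identityʳ p) (p+[q-p]≡q p q) (+-monoʳ-≤ p 0≤q-p)
      where
      p+[q-p]≡q : ∀ p q → p + (q - p) ≡ q
      p+[q-p]≡q = solve-∀ ℚ-ring

    0<q-p⇒p<q : 0ℚ < q - p → p < q
    0<q-p⇒p<q 0<q-p = subst₂ _<_ (+-identityʳ p) (p+[q-p]≡q p q) (+-monoʳ-< p 0<q-p)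
      where
      p+[q-p]≡q : ∀ p q → p + (q - p) ≡ q
      p+[q-p]≡q = solve-∀ ℚ-ring

    p≤p+q : 0ℚ ≤ q → p ≤ p + q
    p≤p+q 0≤q = subst (_≤ p + q) (+-identityʳ p) (+-monoʳ-≤ p 0≤q)

    ≤-by-difference : ∀ r → q - p ≡ r → 0ℚ ≤ r → p ≤ q
    ≤-by-difference r q-p≡r 0≤r = 0≤q-p⇒p≤q (subst (0ℚ ≤_) (sym q-p≡r) 0≤r)

    +-nonNeg : 0ℚ ≤ p → 0ℚ ≤ q → 0ℚ ≤ p + q
    +-nonNeg = +-mono-≤

    *-nonNeg : 0ℚ ≤ p → 0ℚ ≤ q → 0ℚ ≤ p * q
    *-nonNeg 0≤p 0≤q = nonNegative⁻¹ _ {{nonNeg*nonNeg⇒nonNeg p {{nonNegative 0≤p}} q {{nonNegative 0≤q}}}}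

    *-pos : 0ℚ < p → 0ℚ < q → 0ℚ < p * q
    *-pos 0<p 0<q = positive⁻¹ _ {{pos*pos⇒pos p {{positive 0<p}} q {{positive 0<q}}}}

  module _ {r p q : ℚ} where

    *-monoˡ-≤-0≤ : 0ℚ ≤ r → p ≤ q → r * p ≤ r * q
    *-monoˡ-≤-0≤ 0≤r = *-monoˡ-≤-nonNeg r {{nonNegative 0≤r}}

    *-monoʳ-≤-0≤ : 0ℚ ≤ r → p ≤ q → p * r ≤ q * r
    *-monoʳ-≤-0≤ 0≤r = *-monoʳ-≤-nonNeg r {{nonNegative 0≤r}}

    *-cancelˡ-≤-0< : 0ℚ < r → r * p ≤ r * q → p ≤ q
    *-cancelˡ-≤-0< 0<r = *-cancelˡ-≤-pos r {{positive 0<r}}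

    *-cancelʳ-≤-0< : 0ℚ < r → p * r ≤ q * r → p ≤ q
    *-cancelʳ-≤-0< 0<r = *-cancelʳ-≤-pos r {{positive 0<r}}

    *-cancelˡ-<-0< : 0ℚ < r → r * p < r * q → p < q
    *-cancelˡ-<-0< 0<r = *-cancelˡ-<-nonNeg r {{nonNegative (<⇒≤ 0<r)}}

  inverse-cancelʳ : ∀ {h h⁻¹} r → h * h⁻¹ ≡ 1ℚ → r * h⁻¹ * h ≡ r
  inverse-cancelʳ {h} {h⁻¹} r hh⁻¹≡1 =
    trans (*-assoc r h⁻¹ h) (trans (cong (r *_) (trans (*-comm h⁻¹ h) hh⁻¹≡1)) (*-identityʳ r))

  c<b-a⇒a<b-c : ∀ {a b c} → c < b - a → a < b - c
  c<b-a⇒a<b-c {a} {b} {c} c<b-a = 0<q-p⇒p<q (subst (0ℚ <_) (exchange a b c) (p<q⇒0<q-p c<b-a))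
    where
    exchange : ∀ a b c → b - a - c ≡ b - c - a
    exchange = solve-∀ ℚ-ring

  c<b-a⇒a+c<b : ∀ {a b c} → c < b - a → a + c < b
  c<b-a⇒a+c<b {a} {b} {c} c<b-a = 0<q-p⇒p<q (subst (0ℚ <_) (exchange a b c) (p<q⇒0<q-p c<b-a))
    where
    exchange : ∀ a b c → b - a - c ≡ b - (a + c)
    exchange = solve-∀ ℚ-ring

  inverse : ∀ p → 0ℚ < p → ∃ λ h → 0ℚ < h × p * h ≡ 1ℚ
  inverse p 0<p = (1/ p) {{nz}} , positive⁻¹ _ {{1/pos⇒pos p {{positive 0<p}}}} , *-inverseʳ p {{nz}}
    where nz = pos⇒nonZero p {{positive 0<p}}

  square-nonNeg : ∀ p → 0ℚ ≤ p * p
  square-nonNeg p with ≤-total 0ℚ p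
  ... | inj₁ 0≤p = *-nonNeg 0≤p 0≤p
  ... | inj₂ p≤0 = subst (0ℚ ≤_) ([0-p]*[0-p]≡p*p p) (*-nonNeg (p≤q⇒0≤q-p p≤0) (p≤q⇒0≤q-p p≤0))
    where
    [0-p]*[0-p]≡p*p : ∀ p → (0ℚ - p) * (0ℚ - p) ≡ p * p
    [0-p]*[0-p]≡p*p = solve-∀ ℚ-ring

  cube : ℚ → ℚ
  cube p = p * p * p

  cube-mono-≤ : ∀ {p q} → p ≤ q → cube p ≤ cube q
  cube-mono-≤ {p} {q} p≤q = ≤-by-difference _ (difference p q)
    (*-nonNeg (p≤q⇒0≤q-p p≤q) (*-cancelˡ-≤-0< (ι-mono-< {0} {4} (s≤s z≤n))
      (subst₂ _≤_ (sym (*-zeroʳ (ι 4))) (sym (four-times p q))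
        (+-nonNeg (square-nonNeg (q + q + p)) (*-nonNeg (ι-nonNeg 3) (square-nonNeg p))))))
    where
    difference : ∀ x y → y * y * y - x * x * x ≡ (y - x) * (y * y + y * x + x * x)
    difference = solve-∀ ℚ-ring
    four-times : ∀ x y → ι 4 * (y * y + y * x + x * x) ≡ (y + y + x) * (y + y + x) + ι 3 * (x * x)
    four-times = solve-∀ ℚ-ring

  cube-cancel-< : ∀ {p q} → cube p < cube q → p < q
  cube-cancel-< {p} {q} p³<q³ with p <? q
  ... | yes p<q = p<q
  ... | no  p≮q = contradiction (<-≤-trans p³<q³ (cube-mono-≤ (≮⇒≥ p≮q))) (<-irrefl refl)


module CubeRootLimit (t : ℚ.ℚ) (0≤t : ℚ.0ℚ ℚ.≤ t) where

  open RationalArithmetic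
  open import Data.Nat as ℕ using (ℕ; zero; suc)
  import Data.Nat.Properties as ℕ
  open import Data.Rational
  open import Data.Rational.Properties
  open import Data.Product using (∃; _×_; _,_; proj₁; proj₂)
  open import Relation.Binary.PropositionalEquality
  open import Tactic.RingSolver using (solve-∀)

  A : ℚ
  A = 1ℚ + t

  0≤A : 0ℚ ≤ A
  0≤A = +-nonNeg (ι-nonNeg 1) 0≤t

  ℚ³ : Set
  ℚ³ = ℚ × ℚ × ℚ

  transfer : ℚ³ → ℚ³
  transfer (a , b , c) = a + A * b + A * c , a + b + A * c , a + b + c

  head : ℚ³ → ℚ
  head = proj₁

  total : ℚ³ → ℚ
  total (a , b , c) = a + b + c

  infixl 7 _⊙_
  infixl 6 _⊖_

  _⊙_ : ℚ → ℚ³ → ℚ³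
  r ⊙ (a , b , c) = r * a , r * b , r * c

  _⊖_ : ℚ³ → ℚ³ → ℚ³
  (a , b , c) ⊖ (a′ , b′ , c′) = a - a′ , b - b′ , c - c′

  NonNeg³ : ℚ³ → Set
  NonNeg³ (a , b , c) = 0ℚ ≤ a × 0ℚ ≤ b × 0ℚ ≤ c

  record Between (m M : ℚ) (u v : ℚ³) : Set where
    constructor between
    field
      lower : NonNeg³ (v ⊖ m ⊙ u)
      upper : NonNeg³ (M ⊙ u ⊖ v)

  ≡³ : ∀ {a b c a′ b′ c′ : ℚ} → a ≡ a′ → b ≡ b′ → c ≡ c′ → (a , b , c) ≡ (a′ , b′ , c′)
  ≡³ refl refl refl = refl

  transfer-nonNeg : ∀ {u} → NonNeg³ u → NonNeg³ (transfer u)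
  transfer-nonNeg (0≤a , 0≤b , 0≤c) =
    +-nonNeg (+-nonNeg 0≤a (*-nonNeg 0≤A 0≤b)) (*-nonNeg 0≤A 0≤c) ,
    +-nonNeg (+-nonNeg 0≤a 0≤b) (*-nonNeg 0≤A 0≤c) ,
    +-nonNeg (+-nonNeg 0≤a 0≤b) 0≤c

  total-nonNeg : ∀ {u} → NonNeg³ u → 0ℚ ≤ total u
  total-nonNeg (0≤a , 0≤b , 0≤c) = +-nonNeg (+-nonNeg 0≤a 0≤b) 0≤c

  transfer-⊖⊙ : ∀ r u v → transfer (v ⊖ r ⊙ u) ≡ transfer v ⊖ r ⊙ transfer u
  transfer-⊖⊙ r (a , b , c) (a′ , b′ , c′) =
    ≡³ (row₀ t r a b c a′ b′ c′) (row₁ t r a b c a′ b′ c′) (row₂ r a b c a′ b′ c′)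
    where
    row₀ : ∀ t r a b c a′ b′ c′ → a′ - r * a + (1ℚ + t) * (b′ - r * b) + (1ℚ + t) * (c′ - r * c)
         ≡ a′ + (1ℚ + t) * b′ + (1ℚ + t) * c′ - r * (a + (1ℚ + t) * b + (1ℚ + t) * c)
    row₀ = solve-∀ ℚ-ring
    row₁ : ∀ t r a b c a′ b′ c′ → a′ - r * a + (b′ - r * b) + (1ℚ + t) * (c′ - r * c)
         ≡ a′ + b′ + (1ℚ + t) * c′ - r * (a + b + (1ℚ + t) * c)
    row₁ = solve-∀ ℚ-ring
    row₂ : ∀ r a b c a′ b′ c′ → a′ - r * a + (b′ - r * b) + (c′ - r * c)
         ≡ a′ + b′ + c′ - r * (a + b + c)
    row₂ = solve-∀ ℚ-ring

  transfer-⊙⊖ : ∀ r u v → transfer (r ⊙ u ⊖ v) ≡ r ⊙ transfer u ⊖ transfer v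
  transfer-⊙⊖ r (a , b , c) (a′ , b′ , c′) =
    ≡³ (row₀ t r a b c a′ b′ c′) (row₁ t r a b c a′ b′ c′) (row₂ r a b c a′ b′ c′)
    where
    row₀ : ∀ t r a b c a′ b′ c′ → r * a - a′ + (1ℚ + t) * (r * b - b′) + (1ℚ + t) * (r * c - c′)
         ≡ r * (a + (1ℚ + t) * b + (1ℚ + t) * c) - (a′ + (1ℚ + t) * b′ + (1ℚ + t) * c′)
    row₀ = solve-∀ ℚ-ring
    row₁ : ∀ t r a b c a′ b′ c′ → r * a - a′ + (r * b - b′) + (1ℚ + t) * (r * c - c′)
         ≡ r * (a + b + (1ℚ + t) * c) - (a′ + b′ + (1ℚ + t) * c′)
    row₁ = solve-∀ ℚ-ring
    row₂ : ∀ r a b c a′ b′ c′ → r * a - a′ + (r * b - b′) + (r * c - c′)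
         ≡ r * (a + b + c) - (a′ + b′ + c′)
    row₂ = solve-∀ ℚ-ring

  between-transfer : ∀ {m M u v} → Between m M u v → Between m M (transfer u) (transfer v)
  between-transfer {m} {M} {u} {v} (between lower upper) =
    between (subst NonNeg³ (transfer-⊖⊙ m u v) (transfer-nonNeg lower))
            (subst NonNeg³ (transfer-⊙⊖ M u v) (transfer-nonNeg upper))

  total-⊖⊙ : ∀ r u v → total (v ⊖ r ⊙ u) ≡ total v - r * total u
  total-⊖⊙ r (a , b , c) (a′ , b′ , c′) = identity r a b c a′ b′ c′
    where
    identity : ∀ r a b c a′ b′ c′ → a′ - r * a + (b′ - r * b) + (c′ - r * c)
             ≡ a′ + b′ + c′ - r * (a + b + c)
    identity = solve-∀ ℚ-ring

  total-⊙⊖ : ∀ r u v → total (r ⊙ u ⊖ v) ≡ r * total u - total v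
  total-⊙⊖ r (a , b , c) (a′ , b′ , c′) = identity r a b c a′ b′ c′
    where
    identity : ∀ r a b c a′ b′ c′ → r * a - a′ + (r * b - b′) + (r * c - c′)
             ≡ r * (a + b + c) - (a′ + b′ + c′)
    identity = solve-∀ ℚ-ring

  between-total : ∀ {m M u v} → Between m M u v → m * total u ≤ total v × total v ≤ M * total u
  between-total {m} {M} {u} {v} (between lower upper) =
    0≤q-p⇒p≤q (subst (0ℚ ≤_) (total-⊖⊙ m u v) (total-nonNeg lower)) ,
    0≤q-p⇒p≤q (subst (0ℚ ≤_) (total-⊙⊖ M u v) (total-nonNeg upper))

  total≤head-transfer : ∀ {u} → NonNeg³ u → total u ≤ head (transfer u)
  total≤head-transfer {a , b , c} (_ , 0≤b , 0≤c) =
    ≤-by-difference (t * (b + c)) (difference t a b c) (*-nonNeg 0≤t (+-nonNeg 0≤b 0≤c))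
    where
    difference : ∀ t a b c → a + (1ℚ + t) * b + (1ℚ + t) * c - (a + b + c) ≡ t * (b + c)
    difference = solve-∀ ℚ-ring

  head-transfer≤A*total : ∀ {u} → NonNeg³ u → head (transfer u) ≤ A * total u
  head-transfer≤A*total {a , b , c} (0≤a , _ , _) =
    ≤-by-difference (t * a) (difference t a b c) (*-nonNeg 0≤t 0≤a)
    where
    difference : ∀ t a b c → (1ℚ + t) * (a + b + c) - (a + (1ℚ + t) * b + (1ℚ + t) * c) ≡ t * a
    difference = solve-∀ ℚ-ring

  transfer-dominates : ∀ {d z r} → NonNeg³ d → NonNeg³ z → 0ℚ ≤ r → r * head (transfer z) ≡ total d →
                       NonNeg³ (transfer d ⊖ r ⊙ transfer z)
  transfer-dominates {a , b , c} {z₀ , z₁ , z₂} {r} d≥0@(_ , 0≤b , 0≤c) (_ , 0≤z₁ , 0≤z₂) 0≤r rh≡Σd =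
    via ≤-refl (total≤head-transfer d≥0) ,
    via {y = a + b + A * c} (≤-by-difference (t * z₁) (row₁-difference t z₀ z₁ z₂) (*-nonNeg 0≤t 0≤z₁))
        (≤-by-difference (t * c) (row₁-excess t a b c) (*-nonNeg 0≤t 0≤c)) ,
    via (≤-by-difference (t * (z₁ + z₂)) (row₂-difference t z₀ z₁ z₂) (*-nonNeg 0≤t (+-nonNeg 0≤z₁ 0≤z₂)))
        ≤-refl
    where
    via : ∀ {x y} → x ≤ head (transfer (z₀ , z₁ , z₂)) → total (a , b , c) ≤ y → 0ℚ ≤ y - r * x
    via x≤h Σd≤y = p≤q⇒0≤q-p (≤-trans (≤-trans (*-monoˡ-≤-0≤ 0≤r x≤h) (≤-reflexive rh≡Σd)) Σd≤y)
    row₁-difference : ∀ t a b c → a + (1ℚ + t) * b + (1ℚ + t) * c - (a + b + (1ℚ + t) * c) ≡ t * b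
    row₁-difference = solve-∀ ℚ-ring
    row₂-difference : ∀ t a b c → a + (1ℚ + t) * b + (1ℚ + t) * c - (a + b + c) ≡ t * (b + c)
    row₂-difference = solve-∀ ℚ-ring
    row₁-excess : ∀ t a b c → a + b + (1ℚ + t) * c - (a + b + c) ≡ t * c
    row₁-excess = solve-∀ ℚ-ring

  [x⊖my]⊖cy≡x⊖[m+c]y : ∀ x y m c → (x ⊖ m ⊙ y) ⊖ c ⊙ y ≡ x ⊖ (m + c) ⊙ y
  [x⊖my]⊖cy≡x⊖[m+c]y (a , b , c) (a′ , b′ , c′) m r =
    ≡³ (identity a a′ m r) (identity b b′ m r) (identity c c′ m r)
    where
    identity : ∀ x y m c → x - m * y - c * y ≡ x - (m + c) * y
    identity = solve-∀ ℚ-ring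

  [My⊖x]⊖cy≡[M-c]y⊖x : ∀ x y M c → (M ⊙ y ⊖ x) ⊖ c ⊙ y ≡ (M - c) ⊙ y ⊖ x
  [My⊖x]⊖cy≡[M-c]y⊖x (a , b , c) (a′ , b′ , c′) M r =
    ≡³ (identity a a′ M r) (identity b b′ M r) (identity c c′ M r)
    where
    identity : ∀ x y M c → M * y - x - c * y ≡ (M - c) * y - x
    identity = solve-∀ ℚ-ring

  record Contracted (m M : ℚ) (u v : ℚ³) : Set where
    field
      m′ M′   : ℚ
      m≤m′    : m ≤ m′
      bounds′ : Between m′ M′ (transfer u) (transfer v)
      shrink  : (M′ - m′) * A ≤ (M - m) * t

  -- m and M move inward by c = Σ (v - m u) / h and c′ = Σ (M u - v) / h, where h is the
  -- first row of T u: no row of T u exceeds h, no row of T d falls below Σ d for d ≥ 0,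
  -- and h ≤ A Σ u turns c + c′ ≥ (M - m) / A into the width estimate.
  contraction : ∀ {m M u v} → NonNeg³ u → 0ℚ < total u → Between m M u v → Contracted m M u v
  contraction {m} {M} {u} {v} u≥0 0<Σu (between lower upper) = record
    { m′ = m + c ; M′ = M - c′ ; m≤m′ = p≤p+q 0≤c ; bounds′ = between lower′ upper′ ; shrink = width }
    where
    h = head (transfer u)
    0<h : 0ℚ < h
    0<h = <-≤-trans 0<Σu (total≤head-transfer u≥0)
    h⁻¹ = proj₁ (inverse h 0<h)
    0≤h⁻¹ : 0ℚ ≤ h⁻¹
    0≤h⁻¹ = <⇒≤ (proj₁ (proj₂ (inverse h 0<h)))
    divided : ∀ x → x * h⁻¹ * h ≡ x
    divided x = inverse-cancelʳ x (proj₂ (proj₂ (inverse h 0<h)))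
    c c′ : ℚ
    c  = total (v ⊖ m ⊙ u) * h⁻¹
    c′ = total (M ⊙ u ⊖ v) * h⁻¹
    0≤c : 0ℚ ≤ c
    0≤c = *-nonNeg (total-nonNeg lower) 0≤h⁻¹
    0≤c′ : 0ℚ ≤ c′
    0≤c′ = *-nonNeg (total-nonNeg upper) 0≤h⁻¹
    lower′ : NonNeg³ (transfer v ⊖ (m + c) ⊙ transfer u)
    lower′ = subst NonNeg³ (trans (cong (_⊖ c ⊙ transfer u) (transfer-⊖⊙ m u v))
                                  ([x⊖my]⊖cy≡x⊖[m+c]y (transfer v) (transfer u) m c))
                           (transfer-dominates lower u≥0 0≤c (divided (total (v ⊖ m ⊙ u))))
    upper′ : NonNeg³ ((M - c′) ⊙ transfer u ⊖ transfer v)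
    upper′ = subst NonNeg³ (trans (cong (_⊖ c′ ⊙ transfer u) (transfer-⊙⊖ M u v))
                                  ([My⊖x]⊖cy≡[M-c]y⊖x (transfer v) (transfer u) M c′))
                           (transfer-dominates upper u≥0 0≤c′ (divided (total (M ⊙ u ⊖ v))))
    gap : (c + c′) * h ≡ total u * (M - m)
    gap = begin
      (c + c′) * h                                 ≡⟨ *-distribʳ-+ h c c′ ⟩
      c * h + c′ * h
        ≡⟨ cong₂ _+_ (divided (total (v ⊖ m ⊙ u))) (divided (total (M ⊙ u ⊖ v))) ⟩
      total (v ⊖ m ⊙ u) + total (M ⊙ u ⊖ v)       ≡⟨ cong₂ _+_ (total-⊖⊙ m u v) (total-⊙⊖ M u v) ⟩
      (total v - m * total u) + (M * total u - total v) ≡⟨ telescope (total u) (total v) m M ⟩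
      total u * (M - m)                            ∎
      where
      open ≡-Reasoning
      telescope : ∀ Σu Σv m M → (Σv - m * Σu) + (M * Σu - Σv) ≡ Σu * (M - m)
      telescope = solve-∀ ℚ-ring
    M-m≤[c+c′]A : M - m ≤ (c + c′) * A
    M-m≤[c+c′]A = *-cancelˡ-≤-0< 0<Σu (begin
      total u * (M - m)          ≡⟨ gap ⟨
      (c + c′) * h               ≤⟨ *-monoˡ-≤-0≤ (+-nonNeg 0≤c 0≤c′) (head-transfer≤A*total u≥0) ⟩
      (c + c′) * (A * total u)   ≡⟨ reorder (c + c′) A (total u) ⟩
      total u * ((c + c′) * A)   ∎)
      where
      open ≤-Reasoning
      reorder : ∀ x y z → x * (y * z) ≡ z * (x * y)
      reorder = solve-∀ ℚ-ring
    width : (M - c′ - (m + c)) * A ≤ (M - m) * t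
    width = ≤-by-difference _ (difference t m M c c′) (p≤q⇒0≤q-p M-m≤[c+c′]A)
      where
      difference : ∀ t m M c c′ → (M - m) * t - (M - c′ - (m + c)) * (1ℚ + t) ≡ (c + c′) * (1ℚ + t) - (M - m)
      difference = solve-∀ ℚ-ring

  -- μ³ - F μ is the characteristic polynomial of the transfer matrix and of the recurrence.
  F : ℚ → ℚ
  F μ = ι 3 * μ * μ + ι 3 * t * μ + t * t

  C : ℚ
  C = ι 3 * t * (A * A)

  scaled-cube : ∀ μ h → μ * h ≡ 1ℚ → cube μ * cube (1ℚ + t * h) ≡ cube (μ + t)
  scaled-cube μ h μh≡1 = begin
    cube μ * cube (1ℚ + t * h)   ≡⟨ expand t μ h ⟩
    cube (μ + t * (μ * h))       ≡⟨ cong (λ e → cube (μ + t * e)) μh≡1 ⟩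
    cube (μ + t * 1ℚ)            ≡⟨ cong (λ e → cube (μ + e)) (*-identityʳ t) ⟩
    cube (μ + t)                 ∎
    where
    open ≡-Reasoning
    expand : ∀ t μ h → μ * μ * μ * ((1ℚ + t * h) * (1ℚ + t * h) * (1ℚ + t * h))
                     ≡ (μ + t * (μ * h)) * (μ + t * (μ * h)) * (μ + t * (μ * h))
    expand = solve-∀ ℚ-ring

  cube-pos : ∀ {μ} → 1ℚ ≤ μ → 0ℚ < cube μ
  cube-pos 1≤μ = *-pos (*-pos 0<μ 0<μ) 0<μ
    where 0<μ = <-≤-trans (ι-mono-< {0} {1} ℕ.z<s) 1≤μ

  1+t≤cube[1+th] : ∀ {m h} → 1ℚ ≤ m → m * h ≡ 1ℚ → cube m ≤ F m → 1ℚ + t ≤ cube (1ℚ + t * h)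
  1+t≤cube[1+th] {m} {h} 1≤m mh≡1 m³≤Fm = *-cancelˡ-≤-0< (cube-pos 1≤m)
    (subst (cube m * (1ℚ + t) ≤_) (sym (scaled-cube m h mh≡1))
      (≤-by-difference _ (difference t m) (*-nonNeg 0≤t (p≤q⇒0≤q-p m³≤Fm))))
    where
    difference : ∀ t m → (m + t) * (m + t) * (m + t) - m * m * m * (1ℚ + t)
                       ≡ t * (ι 3 * m * m + ι 3 * t * m + t * t - m * m * m)
    difference = solve-∀ ℚ-ring

  cube[1+tl]≤1+t : ∀ {M l} → 1ℚ ≤ M → M * l ≡ 1ℚ → F M ≤ cube M → cube (1ℚ + t * l) ≤ 1ℚ + t
  cube[1+tl]≤1+t {M} {l} 1≤M Ml≡1 FM≤M³ = *-cancelˡ-≤-0< (cube-pos 1≤M)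
    (subst (_≤ cube M * (1ℚ + t)) (sym (scaled-cube M l Ml≡1))
      (≤-by-difference _ (difference t M) (*-nonNeg 0≤t (p≤q⇒0≤q-p FM≤M³))))
    where
    difference : ∀ t M → M * M * M * (1ℚ + t) - (M + t) * (M + t) * (M + t)
                       ≡ t * (M * M * M - (ι 3 * M * M + ι 3 * t * M + t * t))
    difference = solve-∀ ℚ-ring

  cube-gap : ∀ {X Y} → 0ℚ ≤ X → X ≤ Y → Y ≤ A → cube Y - cube X ≤ ι 3 * (A * A) * (Y - X)
  cube-gap {X} {Y} 0≤X X≤Y Y≤A = begin
    cube Y - cube X                        ≡⟨ difference X Y ⟩
    (Y - X) * (Y * Y + Y * X + X * X)      ≤⟨ *-monoˡ-≤-0≤ (p≤q⇒0≤q-p X≤Y) (+-mono-≤ (+-mono-≤ YY YX) XX) ⟩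
    (Y - X) * (A * A + A * A + A * A)      ≡⟨ three-times (Y - X) (A * A) ⟩
    ι 3 * (A * A) * (Y - X)                ∎
    where
    open ≤-Reasoning
    0≤Y = ≤-trans 0≤X X≤Y
    YY : Y * Y ≤ A * A
    YY = ≤-trans (*-monoˡ-≤-0≤ 0≤Y Y≤A) (*-monoʳ-≤-0≤ (≤-trans 0≤Y Y≤A) Y≤A)
    YX : Y * X ≤ A * A
    YX = ≤-trans (*-monoˡ-≤-0≤ 0≤Y X≤Y) YY
    XX : X * X ≤ A * A
    XX = ≤-trans (*-monoʳ-≤-0≤ 0≤X X≤Y) YX
    difference : ∀ x y → y * y * y - x * x * x ≡ (y - x) * (y * y + y * x + x * x)
    difference = solve-∀ ℚ-ring
    three-times : ∀ d a → d * (a + a + a) ≡ ι 3 * a * d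
    three-times = solve-∀ ℚ-ring

  -- 1 + t ρ lies between 1 + t / M and 1 + t / m, whose cubes enclose 1 + t and differ by at most C (M - m).
  cube-sandwich : ∀ {m M ρ} → 1ℚ ≤ m → m ≤ M → cube m ≤ F m → F M ≤ cube M →
    m * ρ ≤ 1ℚ → 1ℚ ≤ M * ρ →
    (1ℚ + t) - C * (M - m) ≤ cube (1ℚ + t * ρ) × cube (1ℚ + t * ρ) ≤ (1ℚ + t) + C * (M - m)
  cube-sandwich {m} {M} {ρ} 1≤m m≤M m³≤Fm FM≤M³ mρ≤1 1≤Mρ = lower , upper
    where
    0≤1 : 0ℚ ≤ 1ℚ
    0≤1 = ι-nonNeg 1
    1≤M = ≤-trans 1≤m m≤M
    0<m = <-≤-trans (ι-mono-< {0} {1} ℕ.z<s) 1≤m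
    0<M = <-≤-trans 0<m m≤M
    h = proj₁ (inverse m 0<m)
    l = proj₁ (inverse M 0<M)
    mh≡1 : m * h ≡ 1ℚ
    mh≡1 = proj₂ (proj₂ (inverse m 0<m))
    Ml≡1 : M * l ≡ 1ℚ
    Ml≡1 = proj₂ (proj₂ (inverse M 0<M))
    0≤h : 0ℚ ≤ h
    0≤h = <⇒≤ (proj₁ (proj₂ (inverse m 0<m)))
    0≤l : 0ℚ ≤ l
    0≤l = <⇒≤ (proj₁ (proj₂ (inverse M 0<M)))
    ρ≤h : ρ ≤ h
    ρ≤h = *-cancelˡ-≤-0< 0<m (≤-trans mρ≤1 (≤-reflexive (sym mh≡1)))
    l≤ρ : l ≤ ρ
    l≤ρ = *-cancelˡ-≤-0< 0<M (≤-trans (≤-reflexive Ml≡1) 1≤Mρ)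
    h≤1 : h ≤ 1ℚ
    h≤1 = *-cancelˡ-≤-0< 0<m (subst₂ _≤_ (sym mh≡1) (sym (*-identityʳ m)) 1≤m)
    l≤1 : l ≤ 1ℚ
    l≤1 = *-cancelˡ-≤-0< 0<M (subst₂ _≤_ (sym Ml≡1) (sym (*-identityʳ M)) 1≤M)
    X Y : ℚ
    X = 1ℚ + t * l
    Y = 1ℚ + t * h
    h-l≤M-m : h - l ≤ M - m
    h-l≤M-m = begin
      h - l                   ≡⟨ sym (cong₂ _-_ (trans (cong (h *_) Ml≡1) (*-identityʳ h))
                                                 (trans (cong (l *_) mh≡1) (*-identityʳ l))) ⟩
      h * (M * l) - l * (m * h) ≡⟨ factor h l m M ⟩
      h * l * (M - m)         ≤⟨ *-monoʳ-≤-0≤ (p≤q⇒0≤q-p m≤M)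
                                   (≤-trans (*-monoˡ-≤-0≤ 0≤h l≤1) (≤-trans (≤-reflexive (*-identityʳ h)) h≤1)) ⟩
      1ℚ * (M - m)            ≡⟨ *-identityˡ (M - m) ⟩
      M - m                   ∎
      where
      open ≤-Reasoning
      factor : ∀ h l m M → h * (M * l) - l * (m * h) ≡ h * l * (M - m)
      factor = solve-∀ ℚ-ring
    gap : cube Y - cube X ≤ C * (M - m)
    gap = begin
      cube Y - cube X
        ≤⟨ cube-gap (+-nonNeg 0≤1 (*-nonNeg 0≤t 0≤l))
                    (+-monoʳ-≤ 1ℚ (*-monoˡ-≤-0≤ 0≤t (≤-trans l≤ρ ρ≤h)))
                    (+-monoʳ-≤ 1ℚ (≤-trans (*-monoˡ-≤-0≤ 0≤t h≤1) (≤-reflexive (*-identityʳ t)))) ⟩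
      ι 3 * (A * A) * (Y - X)           ≡⟨ cong (ι 3 * (A * A) *_) (difference t h l) ⟩
      ι 3 * (A * A) * (t * (h - l))
        ≤⟨ *-monoˡ-≤-0≤ (*-nonNeg (ι-nonNeg 3) (*-nonNeg 0≤A 0≤A)) (*-monoˡ-≤-0≤ 0≤t h-l≤M-m) ⟩
      ι 3 * (A * A) * (t * (M - m))     ≡⟨ reorder A t (M - m) ⟩
      C * (M - m)                       ∎
      where
      open ≤-Reasoning
      difference : ∀ t h l → 1ℚ + t * h - (1ℚ + t * l) ≡ t * (h - l)
      difference = solve-∀ ℚ-ring
      reorder : ∀ a t w → ι 3 * (a * a) * (t * w) ≡ ι 3 * t * (a * a) * w
      reorder = solve-∀ ℚ-ring
    lower : (1ℚ + t) - C * (M - m) ≤ cube (1ℚ + t * ρ)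
    lower = begin
      (1ℚ + t) - C * (M - m)            ≤⟨ +-mono-≤ (1+t≤cube[1+th] 1≤m mh≡1 m³≤Fm) (neg-antimono-≤ gap) ⟩
      cube Y - (cube Y - cube X)        ≡⟨ cancel (cube Y) (cube X) ⟩
      cube X                            ≤⟨ cube-mono-≤ (+-monoʳ-≤ 1ℚ (*-monoˡ-≤-0≤ 0≤t l≤ρ)) ⟩
      cube (1ℚ + t * ρ)                 ∎
      where
      open ≤-Reasoning
      cancel : ∀ y x → y - (y - x) ≡ x
      cancel = solve-∀ ℚ-ring
    upper : cube (1ℚ + t * ρ) ≤ (1ℚ + t) + C * (M - m)
    upper = begin
      cube (1ℚ + t * ρ)                 ≤⟨ cube-mono-≤ (+-monoʳ-≤ 1ℚ (*-monoˡ-≤-0≤ 0≤t ρ≤h)) ⟩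
      cube Y                            ≡⟨ split (cube Y) (cube X) ⟩
      cube X + (cube Y - cube X)        ≤⟨ +-mono-≤ (cube[1+tl]≤1+t 1≤M Ml≡1 FM≤M³) gap ⟩
      (1ℚ + t) + C * (M - m)            ∎
      where
      open ≤-Reasoning
      split : ∀ y x → y ≡ x + (y - x)
      split = solve-∀ ℚ-ring

  cube≤F : ∀ {m s₀ s₁ s₂ s₃} → 0ℚ ≤ m → 0ℚ < s₂ → s₃ ≡ ι 3 * s₂ + ι 3 * t * s₁ + t * t * s₀ →
                m * s₀ ≤ s₁ → m * s₁ ≤ s₂ → m * s₂ ≤ s₃ → cube m ≤ F m
  cube≤F {m} {s₀} {s₁} {s₂} 0≤m 0<s₂ refl ms₀≤s₁ ms₁≤s₂ ms₂≤s₃ = *-cancelˡ-≤-0< 0<s₂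
    (≤-by-difference _ (difference t m s₀ s₁ s₂)
      (+-nonNeg (+-nonNeg (+-nonNeg (*-nonNeg (*-nonNeg (*-nonNeg (ι-nonNeg 3) 0≤t) 0≤m) (p≤q⇒0≤q-p ms₁≤s₂))
                                    (*-nonNeg (*-nonNeg 0≤t 0≤t) (p≤q⇒0≤q-p ms₁≤s₂)))
                          (*-nonNeg (*-nonNeg (*-nonNeg 0≤t 0≤t) 0≤m) (p≤q⇒0≤q-p ms₀≤s₁)))
                (*-nonNeg (*-nonNeg 0≤m 0≤m) (p≤q⇒0≤q-p ms₂≤s₃))))
    where
    difference : ∀ t m s₀ s₁ s₂ → s₂ * (ι 3 * m * m + ι 3 * t * m + t * t) - s₂ * (m * m * m)
      ≡ ι 3 * t * m * (s₂ - m * s₁) + t * t * (s₂ - m * s₁) + t * t * m * (s₁ - m * s₀)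
        + m * m * ((ι 3 * s₂ + ι 3 * t * s₁ + t * t * s₀) - m * s₂)
    difference = solve-∀ ℚ-ring

  F≤cube : ∀ {M s₀ s₁ s₂ s₃} → 0ℚ ≤ M → 0ℚ < s₂ → s₃ ≡ ι 3 * s₂ + ι 3 * t * s₁ + t * t * s₀ →
                s₁ ≤ M * s₀ → s₂ ≤ M * s₁ → s₃ ≤ M * s₂ → F M ≤ cube M
  F≤cube {M} {s₀} {s₁} {s₂} 0≤M 0<s₂ refl s₁≤Ms₀ s₂≤Ms₁ s₃≤Ms₂ = *-cancelˡ-≤-0< 0<s₂
    (≤-by-difference _ (difference t M s₀ s₁ s₂)
      (+-nonNeg (+-nonNeg (+-nonNeg (*-nonNeg (*-nonNeg (*-nonNeg (ι-nonNeg 3) 0≤t) 0≤M) (p≤q⇒0≤q-p s₂≤Ms₁))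
                                    (*-nonNeg (*-nonNeg 0≤t 0≤t) (p≤q⇒0≤q-p s₂≤Ms₁)))
                          (*-nonNeg (*-nonNeg (*-nonNeg 0≤t 0≤t) 0≤M) (p≤q⇒0≤q-p s₁≤Ms₀)))
                (*-nonNeg (*-nonNeg 0≤M 0≤M) (p≤q⇒0≤q-p s₃≤Ms₂))))
    where
    difference : ∀ t M s₀ s₁ s₂ → s₂ * (M * M * M) - s₂ * (ι 3 * M * M + ι 3 * t * M + t * t)
      ≡ ι 3 * t * M * (M * s₁ - s₂) + t * t * (M * s₁ - s₂) + t * t * M * (M * s₀ - s₁)
        + M * M * (M * s₂ - (ι 3 * s₂ + ι 3 * t * s₁ + t * t * s₀))
    difference = solve-∀ ℚ-ring

  transfer-expands : ∀ {u} → NonNeg³ u → NonNeg³ (transfer u ⊖ 1ℚ ⊙ u)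
  transfer-expands {a , b , c} (0≤a , 0≤b , 0≤c) =
    subst (0ℚ ≤_) (sym (row₀ t a b c)) (*-nonNeg 0≤A (+-nonNeg 0≤b 0≤c)) ,
    subst (0ℚ ≤_) (sym (row₁ t a b c)) (+-nonNeg 0≤a (*-nonNeg 0≤A 0≤c)) ,
    subst (0ℚ ≤_) (sym (row₂ a b c)) (+-nonNeg 0≤a 0≤b)
    where
    row₀ : ∀ t a b c → a + (1ℚ + t) * b + (1ℚ + t) * c - 1ℚ * a ≡ (1ℚ + t) * (b + c)
    row₀ = solve-∀ ℚ-ring
    row₁ : ∀ t a b c → a + b + (1ℚ + t) * c - 1ℚ * b ≡ a + (1ℚ + t) * c
    row₁ = solve-∀ ℚ-ring
    row₂ : ∀ a b c → a + b + c - 1ℚ * c ≡ a + b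
    row₂ = solve-∀ ℚ-ring

  bounded-by-least-coordinate : ∀ {a b c v M} → NonNeg³ v → 0ℚ ≤ M → c ≤ a → c ≤ b → total v ≤ M * c →
                                NonNeg³ (M ⊙ (a , b , c) ⊖ v)
  bounded-by-least-coordinate {a} {b} {c} {v₀ , v₁ , v₂} {M} (0≤v₀ , 0≤v₁ , 0≤v₂) 0≤M c≤a c≤b Σv≤Mc =
    below (≤-by-difference _ (part₀ v₀ v₁ v₂) (+-nonNeg 0≤v₁ 0≤v₂)) c≤a ,
    below (≤-by-difference _ (part₁ v₀ v₁ v₂) (+-nonNeg 0≤v₀ 0≤v₂)) c≤b ,
    below (≤-by-difference _ (part₂ v₀ v₁ v₂) (+-nonNeg 0≤v₀ 0≤v₁)) ≤-refl
    where
    below : ∀ {x y} → x ≤ total (v₀ , v₁ , v₂) → c ≤ y → 0ℚ ≤ M * y - x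
    below x≤Σv c≤y = p≤q⇒0≤q-p (≤-trans x≤Σv (≤-trans Σv≤Mc (*-monoˡ-≤-0≤ 0≤M c≤y)))
    part₀ : ∀ a b c → a + b + c - a ≡ b + c
    part₀ = solve-∀ ℚ-ring
    part₁ : ∀ a b c → a + b + c - b ≡ a + c
    part₁ = solve-∀ ℚ-ring
    part₂ : ∀ a b c → a + b + c - c ≡ a + b
    part₂ = solve-∀ ℚ-ring

  0<A : 0ℚ < A
  0<A = <-≤-trans (ι-mono-< {0} {1} ℕ.z<s) (subst (_≤ A) (+-identityʳ 1ℚ) (+-monoʳ-≤ 1ℚ 0≤t))

  -- The widths decay geometrically, but the harmonic bound W₀ A / (A + k) that this step yields suffices.
  harmonic-step : ∀ w w′ k → 0ℚ ≤ w → w′ * A ≤ w * t → w′ * (A + ι (suc k)) ≤ w * (A + ι k)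
  harmonic-step w w′ k 0≤w w′A≤wt = *-cancelˡ-≤-0< 0<A (begin
    A * (w′ * (A + ι (suc k)))          ≡⟨ cong (λ e → A * (w′ * (A + e))) (ι-+ 1 k) ⟩
    A * (w′ * (A + (1ℚ + ι k)))         ≡⟨ reorder A w′ (A + (1ℚ + ι k)) ⟩
    w′ * A * (A + (1ℚ + ι k))           ≤⟨ *-monoʳ-≤-0≤ 0≤A+1+k w′A≤wt ⟩
    w * t * (A + (1ℚ + ι k))            ≡⟨ *-assoc w t _ ⟩
    w * (t * (A + (1ℚ + ι k)))          ≤⟨ *-monoˡ-≤-0≤ 0≤w (≤-by-difference _ (difference t (ι k)) 0≤1+k) ⟩
    w * (A * (A + ι k))                 ≡⟨ swap w A (A + ι k) ⟩
    A * (w * (A + ι k))                 ∎)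
    where
    open ≤-Reasoning
    0≤1+k : 0ℚ ≤ 1ℚ + ι k
    0≤1+k = +-nonNeg (ι-nonNeg 1) (ι-nonNeg k)
    0≤A+1+k : 0ℚ ≤ A + (1ℚ + ι k)
    0≤A+1+k = +-nonNeg 0≤A 0≤1+k
    reorder : ∀ x y z → x * (y * z) ≡ y * x * z
    reorder = solve-∀ ℚ-ring
    swap : ∀ x y z → x * (y * z) ≡ y * (x * z)
    swap = solve-∀ ℚ-ring
    difference : ∀ t K → (1ℚ + t) * ((1ℚ + t) + K) - t * ((1ℚ + t) + (1ℚ + K)) ≡ 1ℚ + K
    difference = solve-∀ ℚ-ring

  module Solution (s : ℕ → ℚ)
    (recurrence : ∀ n → s (3 ℕ.+ n) ≡ ι 3 * s (2 ℕ.+ n) + ι 3 * t * s (1 ℕ.+ n) + t * t * s n)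
    (s-positive : ∀ n → 0ℚ < s n) where

    state : ℕ → ℚ³
    state n = s (2 ℕ.+ n) + t * s (1 ℕ.+ n) + t * (s (1 ℕ.+ n) + t * s n) ,
              s (2 ℕ.+ n) + t * s (1 ℕ.+ n) ,
              s (2 ℕ.+ n)

    transfer-state : ∀ n → transfer (state n) ≡ state (suc n)
    transfer-state n =
      trans (≡³ (row₀ t (s n) (s (1 ℕ.+ n)) (s (2 ℕ.+ n))) (row₁ t (s n) (s (1 ℕ.+ n)) (s (2 ℕ.+ n)))
                (row₂ t (s n) (s (1 ℕ.+ n)) (s (2 ℕ.+ n))))
            (cong (λ s₃ → s₃ + t * s (2 ℕ.+ n) + t * (s (2 ℕ.+ n) + t * s (1 ℕ.+ n)) , s₃ + t * s (2 ℕ.+ n) , s₃)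
                  (sym (recurrence n)))
      where
      row₀ : ∀ t s₀ s₁ s₂ → s₂ + t * s₁ + t * (s₁ + t * s₀) + (1ℚ + t) * (s₂ + t * s₁) + (1ℚ + t) * s₂
           ≡ ι 3 * s₂ + ι 3 * t * s₁ + t * t * s₀ + t * s₂ + t * (s₂ + t * s₁)
      row₀ = solve-∀ ℚ-ring
      row₁ : ∀ t s₀ s₁ s₂ → s₂ + t * s₁ + t * (s₁ + t * s₀) + (s₂ + t * s₁) + (1ℚ + t) * s₂
           ≡ ι 3 * s₂ + ι 3 * t * s₁ + t * t * s₀ + t * s₂
      row₁ = solve-∀ ℚ-ring
      row₂ : ∀ t s₀ s₁ s₂ → s₂ + t * s₁ + t * (s₁ + t * s₀) + (s₂ + t * s₁) + s₂
           ≡ ι 3 * s₂ + ι 3 * t * s₁ + t * t * s₀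
      row₂ = solve-∀ ℚ-ring

    total-state : ∀ n → total (state n) ≡ s (3 ℕ.+ n)
    total-state n = cong (λ u → proj₂ (proj₂ u)) (transfer-state n)

    0≤s : ∀ n → 0ℚ ≤ s n
    0≤s n = <⇒≤ (s-positive n)

    state-nonNeg : ∀ n → NonNeg³ (state n)
    state-nonNeg n =
      +-nonNeg (+-nonNeg (0≤s _) (*-nonNeg 0≤t (0≤s _))) (*-nonNeg 0≤t (+-nonNeg (0≤s _) (*-nonNeg 0≤t (0≤s _)))) ,
      +-nonNeg (0≤s _) (*-nonNeg 0≤t (0≤s _)) ,
      0≤s _

    initial-window : ∃ λ M₀ → Between 1ℚ M₀ (state 0) (state 1)
    initial-window = s 4 * h , between
      (subst (λ v → NonNeg³ (v ⊖ 1ℚ ⊙ state 0)) (transfer-state 0) (transfer-expands (state-nonNeg 0)))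
      (bounded-by-least-coordinate (state-nonNeg 1) (*-nonNeg (0≤s 4) (<⇒≤ 0<h))
      (≤-trans (p≤p+q (*-nonNeg 0≤t (0≤s 1))) (p≤p+q (*-nonNeg 0≤t (+-nonNeg (0≤s 1) (*-nonNeg 0≤t (0≤s 0))))))
      (p≤p+q (*-nonNeg 0≤t (0≤s 1)))
      (≤-reflexive (trans (total-state 1) (sym divided))))
      where
      h = proj₁ (inverse (s 2) (s-positive 2))
      0<h : 0ℚ < h
      0<h = proj₁ (proj₂ (inverse (s 2) (s-positive 2)))
      divided : s 4 * h * s 2 ≡ s 4
      divided = inverse-cancelʳ (s 4) (proj₂ (proj₂ (inverse (s 2) (s-positive 2))))

    W₀ : ℚ
    W₀ = proj₁ initial-window - 1ℚ

    record Window (k : ℕ) : Set where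
      field
        m M    : ℚ
        1≤m    : 1ℚ ≤ m
        bounds : Between m M (state k) (state (suc k))
        narrow : (M - m) * (A + ι k) ≤ W₀ * A

    ratio-bounds : ∀ {m M k} → Between m M (state k) (state (suc k)) →
                   m * s (3 ℕ.+ k) ≤ s (4 ℕ.+ k) × s (4 ℕ.+ k) ≤ M * s (3 ℕ.+ k)
    ratio-bounds {m} {M} {k} b =
      subst₂ (λ x y → m * x ≤ y) (total-state k) (total-state (suc k)) (proj₁ (between-total b)) ,
      subst₂ (λ x y → y ≤ M * x) (total-state k) (total-state (suc k)) (proj₂ (between-total b))

    ordered : ∀ {m M k} → Between m M (state k) (state (suc k)) → m ≤ M
    ordered {k = k} b =
      *-cancelʳ-≤-0< (s-positive (3 ℕ.+ k)) (≤-trans (proj₁ (ratio-bounds b)) (proj₂ (ratio-bounds b)))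

    later : ∀ {m M k} j → Between m M (state k) (state (suc k)) →
            Between m M (state (j ℕ.+ k)) (state (suc (j ℕ.+ k)))
    later zero    b = b
    later {m} {M} (suc j) b =
      subst₂ (Between m M) (transfer-state _) (transfer-state _) (between-transfer (later j b))

    window : ∀ k → Window k
    window zero = record
      { m = 1ℚ ; M = proj₁ initial-window ; 1≤m = ≤-refl
      ; bounds = proj₂ initial-window
      ; narrow = ≤-reflexive (cong (W₀ *_) (+-identityʳ A))
      }
    window (suc k) = record
      { m = m′ ; M = M′ ; 1≤m = ≤-trans 1≤m m≤m′
      ; bounds = subst₂ (Between m′ M′) (transfer-state k) (transfer-state (suc k)) bounds′
      ; narrow = ≤-trans (harmonic-step (M - m) (M′ - m′) k (p≤q⇒0≤q-p (ordered bounds)) shrink) narrow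
      }
      where
      open Window (window k)
      open Contracted (contraction (state-nonNeg k) (subst (0ℚ <_) (sym (total-state k)) (s-positive (3 ℕ.+ k))) bounds)

    width : ℕ → ℚ
    width k = Window.M (window k) - Window.m (window k)

    near-root : ∀ k ρ → ρ * s (4 ℕ.+ k) ≡ s (3 ℕ.+ k) →
      (1ℚ + t) - C * width k ≤ cube (1ℚ + t * ρ) × cube (1ℚ + t * ρ) ≤ (1ℚ + t) + C * width k
    near-root k ρ ρs₄≡s₃ = cube-sandwich 1≤m (ordered bounds)
      (cube≤F 0≤m (s-positive (5 ℕ.+ k)) (recurrence (3 ℕ.+ k))
        (proj₁ (ratio-bounds bounds)) (proj₁ (ratio-bounds (later 1 bounds))) (proj₁ (ratio-bounds (later 2 bounds))))
      (F≤cube (≤-trans 0≤m (ordered bounds)) (s-positive (5 ℕ.+ k)) (recurrence (3 ℕ.+ k))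
        (proj₂ (ratio-bounds bounds)) (proj₂ (ratio-bounds (later 1 bounds))) (proj₂ (ratio-bounds (later 2 bounds))))
      (*-cancelʳ-≤-0< (s-positive (4 ℕ.+ k)) (begin
        m * ρ * s (4 ℕ.+ k)       ≡⟨ trans (*-assoc m ρ _) (cong (m *_) ρs₄≡s₃) ⟩
        m * s (3 ℕ.+ k)           ≤⟨ proj₁ (ratio-bounds bounds) ⟩
        s (4 ℕ.+ k)               ≡⟨ *-identityˡ _ ⟨
        1ℚ * s (4 ℕ.+ k)          ∎))
      (*-cancelʳ-≤-0< (s-positive (4 ℕ.+ k)) (begin
        1ℚ * s (4 ℕ.+ k)          ≡⟨ *-identityˡ _ ⟩
        s (4 ℕ.+ k)               ≤⟨ proj₂ (ratio-bounds bounds) ⟩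
        M * s (3 ℕ.+ k)           ≡⟨ trans (*-assoc M ρ _) (cong (M *_) ρs₄≡s₃) ⟨
        M * ρ * s (4 ℕ.+ k)       ∎))
      where
      open Window (window k)
      open ≤-Reasoning
      0≤m = ≤-trans (ι-nonNeg 1) 1≤m

    eventually-narrow : ∀ ε → 0ℚ < ε → ∃ λ k₀ → ∀ k → k₀ ℕ.≤ k → C * width k < ε
    eventually-narrow ε 0<ε = k₀ , λ k k₀≤k → *-cancelˡ-<-0< (0<A+k k) (begin-strict
      (A + ι k) * (C * width k)   ≡⟨ reorder (A + ι k) C (width k) ⟩
      C * (width k * (A + ι k))   ≤⟨ *-monoˡ-≤-0≤ 0≤C (Window.narrow (window k)) ⟩
      C * (W₀ * A)                ≡⟨ inverse-cancelʳ (C * (W₀ * A)) εε⁻¹≡1 ⟨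
      C * (W₀ * A) * ε⁻¹ * ε      <⟨ *-monoˡ-<-pos ε {{positive 0<ε}} k₀-large ⟩
      ι k₀ * ε                    ≤⟨ *-monoʳ-≤-0≤ (<⇒≤ 0<ε) (≤-trans (ι-mono-≤ k₀≤k) (p≤q+p 0≤A)) ⟩
      (A + ι k) * ε               ∎)
      where
      open ≤-Reasoning
      ε⁻¹ = proj₁ (inverse ε 0<ε)
      εε⁻¹≡1 = proj₂ (proj₂ (inverse ε 0<ε))
      k₀ = proj₁ (archimedean (C * (W₀ * A) * ε⁻¹))
      k₀-large = proj₂ (archimedean (C * (W₀ * A) * ε⁻¹))
      0≤C : 0ℚ ≤ C
      0≤C = *-nonNeg (*-nonNeg (ι-nonNeg 3) 0≤t) (*-nonNeg 0≤A 0≤A)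
      p≤q+p : ∀ {p q} → 0ℚ ≤ q → p ≤ q + p
      p≤q+p {p} {q} 0≤q = subst (p ≤_) (+-comm p q) (p≤p+q 0≤q)
      0<A+k : ∀ k → 0ℚ < A + ι k
      0<A+k k = <-≤-trans 0<A (p≤p+q (ι-nonNeg k))
      reorder : ∀ x c w → x * (c * w) ≡ c * (w * x)
      reorder = solve-∀ ℚ-ring

    converges : ∀ p q → cube p < 1ℚ + t → 1ℚ + t < cube q →
      ∃ λ N → ∀ n → N ℕ.≤ n → ∀ ρ → ρ * s (suc n) ≡ s n → p < 1ℚ + t * ρ × 1ℚ + t * ρ < q
    converges p q p³<1+t 1+t<q³ = 3 ℕ.+ (k₁ ℕ.⊔ k₂) , close
      where
      below-gap = eventually-narrow _ (p<q⇒0<q-p p³<1+t)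
      above-gap = eventually-narrow _ (p<q⇒0<q-p 1+t<q³)
      k₁ = proj₁ below-gap
      k₂ = proj₁ above-gap
      close : ∀ n → 3 ℕ.+ (k₁ ℕ.⊔ k₂) ℕ.≤ n → ∀ ρ → ρ * s (suc n) ≡ s n →
              p < 1ℚ + t * ρ × 1ℚ + t * ρ < q
      close (suc (suc (suc k))) (ℕ.s≤s (ℕ.s≤s (ℕ.s≤s k₁⊔k₂≤k))) ρ ρs≡s =
        cube-cancel-< (<-≤-trans (c<b-a⇒a<b-c {cube p} {1ℚ + t} (proj₂ below-gap k k₁≤k))
                                 (proj₁ (near-root k ρ ρs≡s))) ,
        cube-cancel-< (≤-<-trans (proj₂ (near-root k ρ ρs≡s))
                                 (c<b-a⇒a+c<b {1ℚ + t} {cube q} (proj₂ above-gap k k₂≤k)))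
        where
        k₁≤k = ℕ.≤-trans (ℕ.m≤m⊔n k₁ k₂) k₁⊔k₂≤k
        k₂≤k = ℕ.≤-trans (ℕ.m≤n⊔m k₁ k₂) k₁⊔k₂≤k


open import Defs
open import Data.Nat using (ℕ; _≤_; suc)
import Data.Nat as ℕ
open import Data.Integer using (+_)
open import Data.Rational using (ℚ; _/_; _<_; _*_; _+_; 1ℚ)
open import Data.Product using (∃-syntax; _×_; _,_; proj₁; proj₂)
open import Relation.Binary.PropositionalEquality using (_≡_; cong; cong₂; trans; subst; module ≡-Reasoning)
open Coefficients using (a-recurrence; a-positive)
open RationalArithmetic using (ι; ι-+; ι-*; ι-nonNeg; ι-mono-<; ratio-spec; cube)

ι-a-recurrence : ∀ t n → ι (a (suc t) (3 ℕ.+ n)) ≡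
  ι 3 * ι (a (suc t) (2 ℕ.+ n)) + ι 3 * ι t * ι (a (suc t) (1 ℕ.+ n)) + ι t * ι t * ι (a (suc t) n)
ι-a-recurrence t n = begin
  ι (a (suc t) (3 ℕ.+ n))                               ≡⟨ cong ι (a-recurrence t n) ⟩
  ι (3 ℕ.* a₂ ℕ.+ 3 ℕ.* t ℕ.* a₁ ℕ.+ t ℕ.* t ℕ.* a₀)
    ≡⟨ trans (ι-+ (3 ℕ.* a₂ ℕ.+ 3 ℕ.* t ℕ.* a₁) (t ℕ.* t ℕ.* a₀))
             (cong (_+ ι (t ℕ.* t ℕ.* a₀)) (ι-+ (3 ℕ.* a₂) (3 ℕ.* t ℕ.* a₁))) ⟩
  ι (3 ℕ.* a₂) + ι (3 ℕ.* t ℕ.* a₁) + ι (t ℕ.* t ℕ.* a₀)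
    ≡⟨ cong₂ _+_ (cong₂ _+_ (ι-* 3 a₂) (trans (ι-* (3 ℕ.* t) a₁) (cong (_* ι a₁) (ι-* 3 t))))
                 (trans (ι-* (t ℕ.* t) a₀) (cong (_* ι a₀) (ι-* t t))) ⟩
  ι 3 * ι a₂ + ι 3 * ι t * ι a₁ + ι t * ι t * ι a₀     ∎
  where
  open ≡-Reasoning
  a₀ = a (suc t) n
  a₁ = a (suc t) (1 ℕ.+ n)
  a₂ = a (suc t) (2 ℕ.+ n)

corollary2 : (α : ℕ) → 1 ≤ α → (p q : ℚ) → p * p * p < (+ α) / 1 → (+ α) / 1 < q * q * q →
    ∃[ N ] ((n : ℕ) → N ≤ n → p < x α n × x α n < q)
corollary2 (suc t) _ p q p³<α α<q³ =
  N , λ n N≤n → close n N≤n (ratio (a (suc t) n) (a (suc t) (suc n)))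
                             (ratio-spec (a (suc t) n) (a-positive t (suc n)))
  where
  open CubeRootLimit (ι t) (ι-nonNeg t)
  open Solution (λ n → ι (a (suc t) n)) (ι-a-recurrence t) (λ n → ι-mono-< (a-positive t n))
  α≡1+t : ι (suc t) ≡ 1ℚ + ι t
  α≡1+t = ι-+ 1 t
  limit = converges p q (subst (cube p <_) α≡1+t p³<α) (subst (_< cube q) α≡1+t α<q³)
  N = proj₁ limit
  close = proj₂ limit
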